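{- Let $\mathbf h(x)=h_0+\sum_sh_s(x_s)+\sum_{st\in\mathcal E}h_{st}(x_s,x_t)$ be an energy and let $K_s\subseteq\mathcal L_s$ for $s\in\mathcal V$. Suppose (a) for all $s\in\mathcal V$, $x_s\in\mathcal L_s$, $\hat x_s\in K_s$: $h_s(\max(x_s,\hat x_s))\le h_s(x_s)$; (b) for all $st\in\mathcal E$, $x_{st}\in\mathcal L_s\times\mathcal L_t$, $\hat x_{st}\in K_s\times K_t$: $h_{st}(x_{st}\vee\hat x_{st})\le h_{st}(x_{st})$; (c) for all $s\in\mathcal V$, $\hat x_s\in K_s$, $x_s<\hat x_s$: $h_s(\max(x_s,\hat x_s))<h_s(x_s)$. Then for every $y\in\mathbf L$ with $y_s\in K_s$ for all $s$, the pair $(y,\mathbf L_{\rm top})$ is a weak LP-autarky for $\mathbf h$, where $\mathbf L_{\rm top}$ is the labeling with all components $L$.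
   Context: Let $\mathcal V$ be a finite set, $\mathcal E\subseteq\mathcal V\times\mathcal V$, $L\in\mathbb N$, $\mathcal L_s=\{0,\dots,L\}$ (natural order), $\mathbf L=\prod_s\mathcal L_s$; $\vee$ on pairs is componentwise max. For an energy $\mathbf h$, write $h$ for the vector with components $h_0$, $h_{s,i}=h_s(i)$, $h_{st,ij}=h_{st}(i,j)$, and $\langle h,\mu\rangle=h_0\mu_0+\sum h_{s,i}\mu_{s,i}+\sum h_{st,ij}\mu_{st,ij}$. The local polytope $\Lambda$ is the set of $\mu$ with $\mu_0=1$, $\mu_{s,i}\ge0$, $\mu_{st,ij}\ge0$, $\sum_{ij}\mu_{st,ij}=1$, $\sum_j\mu_{st,ij}=\mu_{s,i}$, $\sum_i\mu_{st,ij}=\mu_{t,j}$ for all $st\in\mathcal E$. For $\mu\in\Lambda$, $y\in\mathbf L$: $(\mu\barwedge y)_0=\mu_0$, $(\mu\barwedge y)_{s,i}=\sum_{i':\min(i',y_s)=i}\mu_{s,i'}$, $(\mu\barwedge y)_{st,ij}=\sum_{(i',j'):\min(i',y_s)=i,\min(j',y_t)=j}\mu_{st,i'j'}$; $\mu\veebar y$ is defined identically with $\max$ instead of $\min$. A pair $(x^{\min},x^{\max})$ with $x^{\min}\le x^{\max}$ componentwise is a weak LP-autarky for $\mathbf h$ if $\langle h,(\mu\veebar x^{\min})\barwedge x^{\max}\rangle\le\langle h,\mu\rangle$ for all $\mu\in\Lambda$ (for $x^{\max}=\mathbf L_{\rm top}$ this reads $\langle h,\mu\veebar x^{\min}\rangle\le\langle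 h,\mu\rangle$).
   Formalization: The energy terms $h_0$, $h_s$, $h_{st}$ take rational values and the points of the local polytope Λ have rational components, rather than real ones. -}

module Defs where

open import Data.Nat as ℕ using (ℕ; zero; suc; _≤ᵇ_)
open import Data.Fin as Fin using (Fin; toℕ; fromℕ)
open import Data.Fin.Properties using (_≟_)
open import Data.Bool using (Bool; true; false; if_then_else_)
open import Data.Rational using (ℚ; 0ℚ; 1ℚ; _+_; _*_; _≤_; _<_)
open import Data.Product using (_×_; _,_)
open import Relation.Binary.PropositionalEquality using (_≡_)
open import Relation.Nullary.Decidable using (does)

Σ : (k : ℕ) → (Fin k → ℚ) → ℚ
Σ zero    f = 0ℚ
Σ (suc k) f = f Fin.zero + Σ k (λ i → f (Fin.suc i))

-- Labels: 𝓛_s = {0,…,L} represented as Fin (suc L) with its natural order.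
Label : ℕ → Set
Label L = Fin (suc L)

minL maxL : {L : ℕ} → Label L → Label L → Label L
minL i j = if toℕ i ≤ᵇ toℕ j then i else j
maxL i j = if toℕ i ≤ᵇ toℕ j then j else i

[_≟ℓ_] : {L : ℕ} → Label L → Label L → ℚ
[ i ≟ℓ j ] = if does (i ≟ j) then 1ℚ else 0ℚ

Labeling : ℕ → ℕ → Set
Labeling n L = Fin n → Label L

top : {n L : ℕ} → Labeling n L
top {L = L} _ = fromℕ L

EdgeSet : ℕ → Set
EdgeSet n = Fin n → Fin n → Bool

-- Energy (as the vector h) and relaxed labelings μ, indexed by (s,i) and (st,ij).
-- Pairwise components are given for every pair s t but only those with st ∈ 𝓔 matter.
record Vector (n L : ℕ) : Set where
  field
    c0  : ℚ
    c1  : Fin n → Label L → ℚ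
    c2  : Fin n → Fin n → Label L → Label L → ℚ
open Vector public

ΣE : {n : ℕ} → EdgeSet n → (Fin n → Fin n → ℚ) → ℚ
ΣE {n} E f = Σ n (λ s → Σ n (λ t → if E s t then f s t else 0ℚ))

⟪_,_⟫[_] : {n L : ℕ} → Vector n L → Vector n L → EdgeSet n → ℚ
⟪_,_⟫[_] {n} {L} h μ E =
  c0 h * c0 μ
  + Σ n (λ s → Σ (suc L) (λ i → c1 h s i * c1 μ s i))
  + ΣE E (λ s t → Σ (suc L) (λ i → Σ (suc L) (λ j → c2 h s t i j * c2 μ s t i j)))

record InΛ {n L : ℕ} (E : EdgeSet n) (μ : Vector n L) : Set where
  field
    norm0   : c0 μ ≡ 1ℚ
    nonneg1 : ∀ s i → 0ℚ ≤ c1 μ s i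
    nonneg2 : ∀ s t → E s t ≡ true → ∀ i j → 0ℚ ≤ c2 μ s t i j
    sum2    : ∀ s t → E s t ≡ true →
              Σ (suc L) (λ i → Σ (suc L) (λ j → c2 μ s t i j)) ≡ 1ℚ
    margˢ   : ∀ s t → E s t ≡ true → ∀ i →
              Σ (suc L) (λ j → c2 μ s t i j) ≡ c1 μ s i
    margᵗ   : ∀ s t → E s t ≡ true → ∀ j →
              Σ (suc L) (λ i → c2 μ s t i j) ≡ c1 μ t j

pushBy : {n L : ℕ} → (Label L → Label L → Label L) →
         Vector n L → Labeling n L → Vector n L
pushBy {n} {L} op μ y = record
  { c0 = c0 μ
  ; c1 = λ s i → Σ (suc L) (λ i′ → [ op i′ (y s) ≟ℓ i ] * c1 μ s i′)
  ; c2 = λ s t i j → Σ (suc L) (λ i′ → Σ (suc L) (λ j′ →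
           ([ op i′ (y s) ≟ℓ i ] * [ op j′ (y t) ≟ℓ j ]) * c2 μ s t i′ j′))
  }

_⊼_ : {n L : ℕ} → Vector n L → Labeling n L → Vector n L
μ ⊼ y = pushBy minL μ y

_⊻_ : {n L : ℕ} → Vector n L → Labeling n L → Vector n L
μ ⊻ y = pushBy maxL μ y

infixl 6 _⊼_ _⊻_

_≤L_ : {n L : ℕ} → Labeling n L → Labeling n L → Set
x ≤L y = ∀ s → x s Fin.≤ y s

WeakLPAutarky : {n L : ℕ} → EdgeSet n → Vector n L →
                Labeling n L → Labeling n L → Set
WeakLPAutarky E h xmin xmax =
  xmin ≤L xmax ×
  (∀ μ → InΛ E μ → ⟪ h , (μ ⊻ xmin) ⊼ xmax ⟫[ E ] ≤ ⟪ h , μ ⟫[ E ])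

{-# OPTIONS --safe #-}
-- Both pushforwards act on ⟨h, μ⟩ by pulling h back along the label maps: the pairing with
-- (μ ⊻ y) ⊼ top is the pairing of μ with i ↦ h(min(max(i, y), L)) = h(max(i, y)). Conditions
-- (a) and (b) say that this pulled-back energy is pointwise at most h, and a nonnegative μ
-- preserves pointwise inequalities.
module Submission where

open import Defs
open import Data.Nat using (ℕ)
open import Data.Fin as Fin using (Fin)
open import Data.Bool using (true)
open import Data.Rational using (_≤_; _<_)
open import Relation.Binary.PropositionalEquality using (_≡_)

open import Algebra.Bundles using (CommutativeRing)
open import Data.Bool using (false; if_then_else_)
open import Data.Bool.Properties using (T-≡)
open import Data.Fin using (fromℕ)
open import Data.Fin.Properties using (≤fromℕ)
open import Data.Nat.Properties using (≤⇒≤ᵇ)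
open import Data.Product using (_,_)
open import Data.Rational using (ℚ; 0ℚ; 1ℚ; _+_; _*_)
open import Data.Rational.Base using (nonNegative)
open import Data.Rational.Properties
  using (+-*-commutativeRing; module ≤-Reasoning; *-assoc; *-identityˡ; *-zeroˡ; +-identityˡ;
         +-identityʳ; +-mono-≤; ≤-refl; ≤-reflexive; *-monoʳ-≤-nonNeg)
open import Function.Bundles using (Equivalence)
open import Relation.Binary.PropositionalEquality using (refl; sym; trans; cong; cong₂; module ≡-Reasoning)
open import Algebra.Properties.Semiring.Sum (CommutativeRing.semiring +-*-commutativeRing)
  using (sum; sum-cong-≗; sum-replicate-zero; ∑-comm; *-distribˡ-sum)
open import Algebra.Properties.CommutativeSemigroup
  (CommutativeRing.*-commutativeSemigroup +-*-commutativeRing) using (x∙yz≈y∙xz)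

Σ≡sum : ∀ k (f : Fin k → ℚ) → Σ k f ≡ sum f
Σ≡sum ℕ.zero    f = refl
Σ≡sum (ℕ.suc k) f = cong (f Fin.zero +_) (Σ≡sum k (λ i → f (Fin.suc i)))

Σ-cong : ∀ k {f g : Fin k → ℚ} → (∀ i → f i ≡ g i) → Σ k f ≡ Σ k g
Σ-cong ℕ.zero    f≗g = refl
Σ-cong (ℕ.suc k) f≗g = cong₂ _+_ (f≗g Fin.zero) (Σ-cong k (λ i → f≗g (Fin.suc i)))

Σ-mono-≤ : ∀ k {f g : Fin k → ℚ} → (∀ i → f i ≤ g i) → Σ k f ≤ Σ k g
Σ-mono-≤ ℕ.zero    f≤g = ≤-refl
Σ-mono-≤ (ℕ.suc k) f≤g = +-mono-≤ (f≤g Fin.zero) (Σ-mono-≤ k (λ i → f≤g (Fin.suc i)))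

*-distribˡ-Σ : ∀ k c (f : Fin k → ℚ) → c * Σ k f ≡ Σ k (λ i → c * f i)
*-distribˡ-Σ k c f = begin
  c * Σ k f                ≡⟨ cong (c *_) (Σ≡sum k f) ⟩
  c * sum f                ≡⟨ *-distribˡ-sum c f ⟩
  sum (λ i → c * f i)      ≡⟨ Σ≡sum k (λ i → c * f i) ⟨
  Σ k (λ i → c * f i)      ∎
  where open ≡-Reasoning

Σ-comm : ∀ k m (f : Fin k → Fin m → ℚ) →
         Σ k (λ i → Σ m (f i)) ≡ Σ m (λ j → Σ k (λ i → f i j))
Σ-comm k m f = begin
  Σ k (λ i → Σ m (f i))          ≡⟨ Σ≡sum k _ ⟩
  sum (λ i → Σ m (f i))          ≡⟨ sum-cong-≗ (λ i → Σ≡sum m (f i)) ⟩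
  sum (λ i → sum (f i))          ≡⟨ ∑-comm f ⟩
  sum (λ j → sum (λ i → f i j))  ≡⟨ sum-cong-≗ (λ j → Σ≡sum k (λ i → f i j)) ⟨
  sum (λ j → Σ k (λ i → f i j))  ≡⟨ Σ≡sum m _ ⟨
  Σ m (λ j → Σ k (λ i → f i j))  ∎
  where open ≡-Reasoning

Σ-zero : ∀ k {f : Fin k → ℚ} → (∀ i → f i ≡ 0ℚ) → Σ k f ≡ 0ℚ
Σ-zero k {f} f≗0 = trans (Σ-cong k f≗0) (trans (Σ≡sum k _) (sum-replicate-zero k))

Σ-[≟ℓ]-* : ∀ L (a : Label L) (f : Label L → ℚ) → Σ (ℕ.suc L) (λ i → [ a ≟ℓ i ] * f i) ≡ f a
Σ-[≟ℓ]-* L Fin.zero f = begin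
  1ℚ * f Fin.zero + Σ L (λ i → 0ℚ * f (Fin.suc i))
    ≡⟨ cong₂ _+_ (*-identityˡ (f Fin.zero)) (Σ-zero L (λ i → *-zeroˡ (f (Fin.suc i)))) ⟩
  f Fin.zero + 0ℚ
    ≡⟨ +-identityʳ (f Fin.zero) ⟩
  f Fin.zero
    ∎
  where open ≡-Reasoning
Σ-[≟ℓ]-* (ℕ.suc L) (Fin.suc a) f = begin
  0ℚ * f Fin.zero + Σ (ℕ.suc L) (λ i → [ a ≟ℓ i ] * f (Fin.suc i))
    ≡⟨ cong₂ _+_ (*-zeroˡ (f Fin.zero)) (Σ-[≟ℓ]-* L a (λ i → f (Fin.suc i))) ⟩
  0ℚ + f (Fin.suc a)
    ≡⟨ +-identityˡ (f (Fin.suc a)) ⟩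
  f (Fin.suc a)
    ∎
  where open ≡-Reasoning

Σ-*-pushforward : ∀ L k (g : Label L → ℚ) (φ : Fin k → Label L) (m : Fin k → ℚ) →
  Σ (ℕ.suc L) (λ i → g i * Σ k (λ i′ → [ φ i′ ≟ℓ i ] * m i′)) ≡ Σ k (λ i′ → g (φ i′) * m i′)
Σ-*-pushforward L k g φ m = begin
  Σ (ℕ.suc L) (λ i → g i * Σ k (λ i′ → [ φ i′ ≟ℓ i ] * m i′))
    ≡⟨ Σ-cong (ℕ.suc L) (λ i → *-distribˡ-Σ k (g i) (λ i′ → [ φ i′ ≟ℓ i ] * m i′)) ⟩
  Σ (ℕ.suc L) (λ i → Σ k (λ i′ → g i * ([ φ i′ ≟ℓ i ] * m i′)))
    ≡⟨ Σ-comm (ℕ.suc L) k (λ i i′ → g i * ([ φ i′ ≟ℓ i ] * m i′)) ⟩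
  Σ k (λ i′ → Σ (ℕ.suc L) (λ i → g i * ([ φ i′ ≟ℓ i ] * m i′)))
    ≡⟨ Σ-cong k (λ i′ → Σ-cong (ℕ.suc L) (λ i → x∙yz≈y∙xz (g i) [ φ i′ ≟ℓ i ] (m i′))) ⟩
  Σ k (λ i′ → Σ (ℕ.suc L) (λ i → [ φ i′ ≟ℓ i ] * (g i * m i′)))
    ≡⟨ Σ-cong k (λ i′ → Σ-[≟ℓ]-* L (φ i′) (λ i → g i * m i′)) ⟩
  Σ k (λ i′ → g (φ i′) * m i′)
    ∎
  where open ≡-Reasoning

Σ²-*-pushforward : ∀ L k k′ (g : Label L → Label L → ℚ) (φ : Fin k → Label L) (ψ : Fin k′ → Label L)
  (m : Fin k → Fin k′ → ℚ) →
  Σ (ℕ.suc L) (λ i → Σ (ℕ.suc L) (λ j → g i j *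
      Σ k (λ i′ → Σ k′ (λ j′ → ([ φ i′ ≟ℓ i ] * [ ψ j′ ≟ℓ j ]) * m i′ j′))))
  ≡ Σ k (λ i′ → Σ k′ (λ j′ → g (φ i′) (ψ j′) * m i′ j′))
Σ²-*-pushforward L k k′ g φ ψ m = begin
  Σ (ℕ.suc L) (λ i → Σ (ℕ.suc L) (λ j → g i j *
      Σ k (λ i′ → Σ k′ (λ j′ → ([ φ i′ ≟ℓ i ] * [ ψ j′ ≟ℓ j ]) * m i′ j′))))
    ≡⟨ Σ-cong (ℕ.suc L) (λ i → Σ-cong (ℕ.suc L) (λ j → cong (g i j *_) (Σ-cong k (λ i′ →
         trans (Σ-cong k′ (λ j′ → *-assoc [ φ i′ ≟ℓ i ] [ ψ j′ ≟ℓ j ] (m i′ j′)))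
               (sym (*-distribˡ-Σ k′ [ φ i′ ≟ℓ i ] (λ j′ → [ ψ j′ ≟ℓ j ] * m i′ j′))))))) ⟩
  Σ (ℕ.suc L) (λ i → Σ (ℕ.suc L) (λ j → g i j * Σ k (λ i′ → [ φ i′ ≟ℓ i ] * n i′ j)))
    ≡⟨ Σ-comm (ℕ.suc L) (ℕ.suc L) (λ i j → g i j * Σ k (λ i′ → [ φ i′ ≟ℓ i ] * n i′ j)) ⟩
  Σ (ℕ.suc L) (λ j → Σ (ℕ.suc L) (λ i → g i j * Σ k (λ i′ → [ φ i′ ≟ℓ i ] * n i′ j)))
    ≡⟨ Σ-cong (ℕ.suc L) (λ j → Σ-*-pushforward L k (λ i → g i j) φ (λ i′ → n i′ j)) ⟩
  Σ (ℕ.suc L) (λ j → Σ k (λ i′ → g (φ i′) j * n i′ j))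
    ≡⟨ Σ-comm (ℕ.suc L) k (λ j i′ → g (φ i′) j * n i′ j) ⟩
  Σ k (λ i′ → Σ (ℕ.suc L) (λ j → g (φ i′) j * n i′ j))
    ≡⟨ Σ-cong k (λ i′ → Σ-*-pushforward L k′ (g (φ i′)) ψ (m i′)) ⟩
  Σ k (λ i′ → Σ k′ (λ j′ → g (φ i′) (ψ j′) * m i′ j′))
    ∎
  where
  open ≡-Reasoning
  n : Fin k → Label L → ℚ
  n i′ j = Σ k′ (λ j′ → [ ψ j′ ≟ℓ j ] * m i′ j′)

ΣE-cong : ∀ {n} (E : EdgeSet n) {f g : Fin n → Fin n → ℚ} →
          (∀ s t → f s t ≡ g s t) → ΣE E f ≡ ΣE E g
ΣE-cong {n} E f≗g =
  Σ-cong n (λ s → Σ-cong n (λ t → cong (λ x → if E s t then x else 0ℚ) (f≗g s t)))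

ΣE-mono-≤ : ∀ {n} (E : EdgeSet n) {f g : Fin n → Fin n → ℚ} →
            (∀ s t → E s t ≡ true → f s t ≤ g s t) → ΣE E f ≤ ΣE E g
ΣE-mono-≤ {n} E {f} {g} f≤g = Σ-mono-≤ n (λ s → Σ-mono-≤ n (λ t → on-edges s t))
  where
  on-edges : ∀ s t → (if E s t then f s t else 0ℚ) ≤ (if E s t then g s t else 0ℚ)
  on-edges s t with E s t in st∈E
  ... | true  = f≤g s t st∈E
  ... | false = ≤-refl

pullBy : ∀ {n L} → (Label L → Label L → Label L) → Vector n L → Labeling n L → Vector n L
pullBy op h y = record
  { c0 = c0 h
  ; c1 = λ s i → c1 h s (op i (y s))
  ; c2 = λ s t i j → c2 h s t (op i (y s)) (op j (y t))
  }

⟪⟫-pushBy : ∀ {n L} (E : EdgeSet n) (op : Label L → Label L → Label L)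
            (h μ : Vector n L) (y : Labeling n L) →
            ⟪ h , pushBy op μ y ⟫[ E ] ≡ ⟪ pullBy op h y , μ ⟫[ E ]
⟪⟫-pushBy {n} {L} E op h μ y = cong₂ _+_
  (cong (c0 h * c0 μ +_) (Σ-cong n (λ s →
    Σ-*-pushforward L (ℕ.suc L) (c1 h s) (λ i′ → op i′ (y s)) (c1 μ s))))
  (ΣE-cong E (λ s t →
    Σ²-*-pushforward L (ℕ.suc L) (ℕ.suc L) (c2 h s t) (λ i′ → op i′ (y s)) (λ j′ → op j′ (y t)) (c2 μ s t)))

⟪⟫-monoˡ-≤ : ∀ {n L} (E : EdgeSet n) {g h μ : Vector n L} →
             (∀ s i → 0ℚ ≤ c1 μ s i) → (∀ s t → E s t ≡ true → ∀ i j → 0ℚ ≤ c2 μ s t i j) →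
             c0 g ≡ c0 h → (∀ s i → c1 g s i ≤ c1 h s i) →
             (∀ s t → E s t ≡ true → ∀ i j → c2 g s t i j ≤ c2 h s t i j) →
             ⟪ g , μ ⟫[ E ] ≤ ⟪ h , μ ⟫[ E ]
⟪⟫-monoˡ-≤ {n} {L} E {μ = μ} μ₁≥0 μ₂≥0 g₀≡h₀ g₁≤h₁ g₂≤h₂ =
  +-mono-≤
    (+-mono-≤ (≤-reflexive (cong (_* c0 μ) g₀≡h₀))
      (Σ-mono-≤ n (λ s → Σ-mono-≤ (ℕ.suc L) (λ i →
        *-monoˡ-≤ (c1 μ s i) (μ₁≥0 s i) (g₁≤h₁ s i)))))
    (ΣE-mono-≤ E (λ s t st∈E → Σ-mono-≤ (ℕ.suc L) (λ i → Σ-mono-≤ (ℕ.suc L) (λ j →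
      *-monoˡ-≤ (c2 μ s t i j) (μ₂≥0 s t st∈E i j) (g₂≤h₂ s t st∈E i j)))))
  where
  *-monoˡ-≤ : ∀ {a b} m → 0ℚ ≤ m → a ≤ b → a * m ≤ b * m
  *-monoˡ-≤ m m≥0 = *-monoʳ-≤-nonNeg m {{nonNegative m≥0}}

minL-≤ : ∀ {L} {i j : Label L} → i Fin.≤ j → minL i j ≡ i
minL-≤ i≤j rewrite Equivalence.to T-≡ (≤⇒≤ᵇ i≤j) = refl

mainTheorem7 : (n L : ℕ) (E : EdgeSet n) (h : Vector n L)
    (K : Fin n → Label L → Set) →
    (∀ s (x x̂ : Label L) → K s x̂ → c1 h s (maxL x x̂) ≤ c1 h s x) →
    (∀ s t → E s t ≡ true → ∀ (xs xt x̂s x̂t : Label L) → K s x̂s → K t x̂t →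
       c2 h s t (maxL xs x̂s) (maxL xt x̂t) ≤ c2 h s t xs xt) →
    (∀ s (x x̂ : Label L) → K s x̂ → x Fin.< x̂ → c1 h s (maxL x x̂) < c1 h s x) →
    (y : Labeling n L) → (∀ s → K s (y s)) →
    WeakLPAutarky E h y top
mainTheorem7 n L E h K unary-decreases pairwise-decreases _ y y∈K = (λ s → ≤fromℕ (y s)) , decreases
  where
  below-top : ∀ i → minL i (fromℕ L) ≡ i
  below-top i = minL-≤ (≤fromℕ i)

  decreases : ∀ μ → InΛ E μ → ⟪ h , (μ ⊻ y) ⊼ top ⟫[ E ] ≤ ⟪ h , μ ⟫[ E ]
  decreases μ μ∈Λ = begin
    ⟪ h , (μ ⊻ y) ⊼ top ⟫[ E ]                      ≡⟨ ⟪⟫-pushBy E minL h (μ ⊻ y) top ⟩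
    ⟪ pullBy minL h top , μ ⊻ y ⟫[ E ]              ≡⟨ ⟪⟫-pushBy E maxL (pullBy minL h top) μ y ⟩
    ⟪ pullBy maxL (pullBy minL h top) y , μ ⟫[ E ]  ≤⟨ ⟪⟫-monoˡ-≤ E {h = h} nonneg1 nonneg2 refl unary pairwise ⟩
    ⟪ h , μ ⟫[ E ]                                  ∎
    where
    open InΛ μ∈Λ
    open ≤-Reasoning
    unary : ∀ s i → c1 h s (minL (maxL i (y s)) (fromℕ L)) ≤ c1 h s i
    unary s i rewrite below-top (maxL i (y s)) = unary-decreases s i (y s) (y∈K s)
    pairwise : ∀ s t → E s t ≡ true → ∀ i j →
               c2 h s t (minL (maxL i (y s)) (fromℕ L)) (minL (maxL j (y t)) (fromℕ L)) ≤ c2 h s t i j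
    pairwise s t st∈E i j rewrite below-top (maxL i (y s)) | below-top (maxL j (y t)) =
      pairwise-decreases s t st∈E i j (y s) (y t) (y∈K s) (y∈K t)
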